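{- For every integer $k \geq 4$, let $G$ be the tree constructed as follows. Take a vertex $v_0$ adjacent to three vertices $v_1, v_2, v_3$ (and to no other vertices). Attach to $v_1$ three pendant paths with two vertices each, to $v_2$ exactly $k$ pendant paths with two vertices each, and to $v_3$ exactly $k+1$ pendant paths with two vertices each; here attaching a pendant path $a b$ (a copy of $K_2$) to $v_i$ means adding new vertices $a, b$ and edges $v_i a$ and $a b$. Then the independence polynomial of $G$ is not log-concave.
   Context: An independent set in a graph is a set of pairwise non-adjacent vertices; $\alpha(G)$ denotes the maximum size of an independent set. The independence polynomial of $G$ is $I(G;x)=\sum_{k=0}^{\alpha(G)} s_k x^k$, where $s_k$ is the number of independent sets of size $k$ in $G$. A polynomial $\sum_{k=0}^{n} a_k x^k$ is called log-concave if its coefficient sequence satisfies $a_k^2 \geq a_{k-1}a_{k+1}$ for all $k\in\{1,\dots,n-1\}$. -}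

module Defs where

open import Data.Nat using (ℕ; zero; suc; _+_; _*_; _∸_; _<ᵇ_; _≡ᵇ_)
open import Data.Bool using (Bool; true; false; _∧_; not; if_then_else_)
open import Data.List using (List; []; _∷_; _++_; map; concatMap; upTo; filter; length)
open import Data.Vec using (Vec; []; _∷_)
open import Data.Product using (_×_; _,_)
open import Relation.Binary.PropositionalEquality using (_≡_)
open import Data.Bool using (_≟_)
open import Data.Fin.Subset using (Subset; ∣_∣)

-- A finite (simple) graph on the vertex set {0, 1, ..., order - 1},
-- given by its list of edges (unordered pairs, each listed once).
record Graph : Set where
  field
    order : ℕ
    edges : List (ℕ × ℕ)
open Graph public

-- Membership of a vertex (given as a natural number) in a subset of
-- {0,...,n-1}; indices outside the range are never members.
_∈ˢ_ : {n : ℕ} → ℕ → Subset n → Bool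
_∈ˢ_ {zero} i [] = false
_∈ˢ_ {suc n} zero (b ∷ S) = b
_∈ˢ_ {suc n} (suc i) (b ∷ S) = i ∈ˢ S

allᵇ : {A : Set} → (A → Bool) → List A → Bool
allᵇ p [] = true
allᵇ p (x ∷ xs) = p x ∧ allᵇ p xs

isIndependent : (G : Graph) → Subset (order G) → Bool
isIndependent G S = allᵇ (λ { (u , v) → not ((u ∈ˢ S) ∧ (v ∈ˢ S)) }) (edges G)

allSubsets : (n : ℕ) → List (Subset n)
allSubsets zero = [] ∷ []
allSubsets (suc n) = map (true ∷_) (allSubsets n) ++ map (false ∷_) (allSubsets n)

-- s G j = number of independent sets of size j in G, i.e. the j-th
-- coefficient of the independence polynomial I(G; x).
indepCount : Graph → ℕ → ℕ
indepCount G j =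
  length (filter (λ S → isIndependent G S ∧ (∣ S ∣ ≡ᵇ j) ≟ true)
                 (allSubsets (order G)))

LogConcave : (d : ℕ) → (ℕ → ℕ) → Set
LogConcave d a = (i : ℕ) → 1 Data.Nat.≤ i → suc i Data.Nat.≤ d →
                 a (i ∸ 1) * a (i + 1) Data.Nat.≤ a i * a i

-- The independence polynomial of G is log-concave. (Its degree is α(G) ≤ order G;
-- all coefficients s_j with j > α(G) are 0, so quantifying over i with
-- i + 1 ≤ order G gives exactly the condition for i ∈ {1, ..., α(G) - 1}
-- plus trivially true instances.)
IndepPolyLogConcave : Graph → Set
IndepPolyLogConcave G = LogConcave (order G) (indepCount G)

-- Vertices: 0 = v0, 1 = v1, 2 = v2, 3 = v3.
-- Pendant paths are numbered p = 0, ..., m-1 with m = 3 + k + (k+1);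
-- path p has vertices a_p = 4 + 2p and b_p = 5 + 2p, and is attached to
-- v1 if p < 3, to v2 if 3 ≤ p < 3 + k, and to v3 otherwise.
numPaths : ℕ → ℕ
numPaths k = 3 + k + (k + 1)

attach : ℕ → ℕ → ℕ
attach k p = if p <ᵇ 3 then 1 else (if p <ᵇ 3 + k then 2 else 3)

treeG : ℕ → Graph
treeG k = record
  { order = 4 + 2 * numPaths k
  ; edges = (0 , 1) ∷ (0 , 2) ∷ (0 , 3) ∷
            concatMap (λ p → (attach k p , 4 + 2 * p) ∷ (4 + 2 * p , 5 + 2 * p) ∷ [])
                      (upTo (numPaths k))
  }

-- An independent set S of T_k is determined by its trace H on the hub {v₀, v₁, v₂, v₃} and
-- its trace on the m = 2k + 4 pendant paths. Given H, the paths are independent of each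
-- other: a path whose anchor lies in H can contribute only its far end (weight 1), any
-- other path either of its two vertices (weight 2). Hence s_j is a sum over independent
-- hubs H of the elementary symmetric functions e_{j - |H|} of these weights. Only e_m
-- (the product of the weights), and e_{m-1} when all weights are 1, matter near the top:
-- with X = 2^k this gives s_{m+2} = m + 8 + 3X, s_{m+1} ≥ 18X² + 24X and s_{m+3} ≥ 1.
-- For k ≥ 4 we have m + 8 ≤ X + 4 and X ≥ 16, so s_{m+2}² ≤ (4X + 4)² < s_{m+1} s_{m+3}.
module Submission where

open import Data.Bool using (Bool; true; false; _∧_; not; if_then_else_; _≟_)
open import Data.Bool.Properties using (∧-zeroʳ; ∧-assoc)
open import Data.Fin.Subset using (Subset; ∣_∣)
open import Data.List using (List; []; _∷_; _++_; map; filter; length; concatMap; applyUpTo; upTo; replicate)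
open import Data.List.Properties
  using (filter-++; filter-none; length-++; length-map; length-replicate; map-++; map-replicate; map-upTo)
open import Data.List.Relation.Unary.All using (All; []; _∷_; universal)
open import Data.List.Relation.Unary.All.Properties using (map⁺; ++⁺; replicate⁺)
open import Data.Nat using (ℕ; zero; suc; _+_; _*_; _∸_; _^_; _≡ᵇ_; _<ᵇ_; _<_; _≤_; s≤s; z≤n)
open import Data.Nat.Combinatorics using (_C_; nCk+nC[k+1]≡[n+1]C[k+1]; nCk≡nC[n∸k]; nC1≡n)
open import Data.Nat.ListAction using (product)
open import Data.Nat.ListAction.Properties using (product-++)
open import Data.Nat.Properties
  using ( +-comm; +-assoc; +-identityʳ; *-identityˡ; *-identityʳ; *-zeroʳ; *-suc; suc-injective
        ; ^-zeroˡ; ^-distribˡ-+-*; m^n>0; m+n∸n≡m; m+[n∸m]≡n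
        ; ≤-trans; ≤-reflexive; n≤1+n; n<1+n; m<n⇒m<1+n; m≤m+n; m≤n+m; <⇒≱
        ; +-mono-≤; +-monoˡ-≤; +-monoʳ-≤; *-mono-≤; *-monoˡ-≤; *-monoʳ-≤; module ≤-Reasoning)
open import Data.Nat.Tactic.RingSolver using (solve-∀)
open import Data.Product using (_×_; _,_)
open import Data.Vec using ([]; _∷_)
open import Function using (_∘_)
open import Relation.Binary.PropositionalEquality
open import Relation.Nullary using (¬_; contradiction)

open import Defs

count : (n : ℕ) → (Subset n → Bool) → ℕ → ℕ
count zero P j = if P [] ∧ (0 ≡ᵇ j) then 1 else 0
count (suc n) P zero = count n (λ S → P (false ∷ S)) zero
count (suc n) P (suc j) = count n (λ S → P (true ∷ S)) j + count n (λ S → P (false ∷ S)) (suc j)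

length-filter-map : ∀ {A B : Set} (Q : B → Bool) (f : A → B) xs →
  length (filter (λ y → Q y ≟ true) (map f xs)) ≡ length (filter (λ x → Q (f x) ≟ true) xs)
length-filter-map Q f [] = refl
length-filter-map Q f (x ∷ xs) with Q (f x)
... | true = cong suc (length-filter-map Q f xs)
... | false = length-filter-map Q f xs

length-filter-∧-false : ∀ {A : Set} (Q : A → Bool) xs → length (filter (λ x → Q x ∧ false ≟ true) xs) ≡ 0
length-filter-∧-false Q xs = cong length (filter-none (λ x → Q x ∧ false ≟ true) (universal rejected xs))
  where
  rejected = λ x Qx∧false → contradiction (trans (sym (∧-zeroʳ (Q x))) Qx∧false) λ ()

length-filter-allSubsets-suc : ∀ n (Q : Subset (suc n) → Bool) →
  length (filter (λ S → Q S ≟ true) (allSubsets (suc n))) ≡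
  length (filter (λ S → Q (true ∷ S) ≟ true) (allSubsets n)) +
  length (filter (λ S → Q (false ∷ S) ≟ true) (allSubsets n))
length-filter-allSubsets-suc n Q = begin
  length (filter Q? (with0 ++ without0))              ≡⟨ cong length (filter-++ Q? with0 without0) ⟩
  length (filter Q? with0 ++ filter Q? without0)      ≡⟨ length-++ (filter Q? with0) ⟩
  length (filter Q? with0) + length (filter Q? without0)
    ≡⟨ cong₂ _+_ (length-filter-map Q (true ∷_) (allSubsets n)) (length-filter-map Q (false ∷_) (allSubsets n)) ⟩
  length (filter (λ S → Q (true ∷ S) ≟ true) (allSubsets n)) +
  length (filter (λ S → Q (false ∷ S) ≟ true) (allSubsets n)) ∎
  where
  open ≡-Reasoning
  Q? = λ S → Q S ≟ true
  with0 = map (true ∷_) (allSubsets n)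
  without0 = map (false ∷_) (allSubsets n)

length-filter-allSubsets : ∀ n (P : Subset n → Bool) j →
  length (filter (λ S → P S ∧ (∣ S ∣ ≡ᵇ j) ≟ true) (allSubsets n)) ≡ count n P j
length-filter-allSubsets zero P j with P [] ∧ (0 ≡ᵇ j)
... | true = refl
... | false = refl
length-filter-allSubsets (suc n) P zero =
  trans (length-filter-allSubsets-suc n (λ S → P S ∧ (∣ S ∣ ≡ᵇ 0)))
        (cong₂ _+_ (length-filter-∧-false (λ S → P (true ∷ S)) (allSubsets n))
                   (length-filter-allSubsets n (λ S → P (false ∷ S)) zero))
length-filter-allSubsets (suc n) P (suc j) =
  trans (length-filter-allSubsets-suc n (λ S → P S ∧ (∣ S ∣ ≡ᵇ suc j)))
        (cong₂ _+_ (length-filter-allSubsets n (λ S → P (true ∷ S)) j)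
                   (length-filter-allSubsets n (λ S → P (false ∷ S)) (suc j)))

indepCount≡count : ∀ G j → indepCount G j ≡ count (order G) (isIndependent G) j
indepCount≡count G = length-filter-allSubsets (order G) (isIndependent G)

count-cong : ∀ n {P Q : Subset n → Bool} j → (∀ S → P S ≡ Q S) → count n P j ≡ count n Q j
count-cong zero j P≡Q rewrite P≡Q [] = refl
count-cong (suc n) zero P≡Q = count-cong n zero (λ S → P≡Q (false ∷ S))
count-cong (suc n) (suc j) P≡Q =
  cong₂ _+_ (count-cong n j (λ S → P≡Q (true ∷ S))) (count-cong n (suc j) (λ S → P≡Q (false ∷ S)))

count-reject : ∀ n (P : Subset n → Bool) j → (∀ S → P S ≡ false) → count n P j ≡ 0
count-reject zero P j P≡false rewrite P≡false [] = refl
count-reject (suc n) P zero P≡false = count-reject n _ zero (λ S → P≡false (false ∷ S))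
count-reject (suc n) P (suc j) P≡false =
  cong₂ _+_ (count-reject n _ j (λ S → P≡false (true ∷ S)))
            (count-reject n _ (suc j) (λ S → P≡false (false ∷ S)))

count-reject-true∷ : ∀ n (P : Subset (suc n) → Bool) j → (∀ S → P (true ∷ S) ≡ false) →
  count (suc n) P j ≡ count n (λ S → P (false ∷ S)) j
count-reject-true∷ n P zero _ = refl
count-reject-true∷ n P (suc j) P≡false =
  cong (_+ count n (λ S → P (false ∷ S)) (suc j)) (count-reject n _ j P≡false)

count-∧ˡ : ∀ n b (P : Subset n → Bool) j → count n (λ S → b ∧ P S) j ≡ (if b then count n P j else 0)
count-∧ˡ n true P j = refl
count-∧ˡ n false P j = count-reject n _ j (λ _ → refl)

-- Elementary symmetric functions

-- esym ws j is the coefficient of x^j in the product of the factors 1 + w x, w ∈ ws.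
esym : List ℕ → ℕ → ℕ
esym ws zero = 1
esym [] (suc j) = 0
esym (w ∷ ws) (suc j) = esym ws (suc j) + w * esym ws j

esym-above : ∀ ws {j} → length ws < j → esym ws j ≡ 0
esym-above [] {suc j} _ = refl
esym-above (w ∷ ws) {suc j} (s≤s l<j) = begin
  esym ws (suc j) + w * esym ws j ≡⟨ cong₂ (λ x y → x + w * y) (esym-above ws (m<n⇒m<1+n l<j)) (esym-above ws l<j) ⟩
  0 + w * 0                       ≡⟨ *-zeroʳ w ⟩
  0                               ∎
  where open ≡-Reasoning

esym-top : ∀ ws → esym ws (length ws) ≡ product ws
esym-top [] = refl
esym-top (w ∷ ws) = cong₂ (λ x y → x + w * y) (esym-above ws (n<1+n (length ws))) (esym-top ws)

esym-all-one : ∀ {ws} → All (_≡ 1) ws → ∀ j → esym ws j ≡ length ws C j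
esym-all-one _ zero = refl
esym-all-one [] (suc j) = refl
esym-all-one {1 ∷ ws} (refl ∷ ones) (suc j) = begin
  esym ws (suc j) + 1 * esym ws j ≡⟨ cong₂ (λ x y → x + 1 * y) (esym-all-one ones (suc j)) (esym-all-one ones j) ⟩
  l C suc j + 1 * (l C j)         ≡⟨ cong (l C suc j +_) (*-identityˡ (l C j)) ⟩
  l C suc j + l C j               ≡⟨ +-comm (l C suc j) (l C j) ⟩
  l C j + l C suc j               ≡⟨ nCk+nC[k+1]≡[n+1]C[k+1] l j ⟩
  suc l C suc j                   ∎
  where
  open ≡-Reasoning
  l = length ws

[1+n]C[n]≡1+n : ∀ n → suc n C n ≡ suc n
[1+n]C[n]≡1+n n = begin
  suc n C n           ≡⟨ nCk≡nC[n∸k] (n≤1+n n) ⟩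
  suc n C (suc n ∸ n) ≡⟨ cong (suc n C_) (m+n∸n≡m 1 n) ⟩
  suc n C 1           ≡⟨ nC1≡n (suc n) ⟩
  suc n               ∎
  where open ≡-Reasoning

weight : Bool → ℕ
weight true = 1
weight false = 2

-- The flags say, path by path, whether the anchor of the path lies in the set; S lists the
-- two vertices of each path in turn (a list of the wrong length yields the junk value false).
pathsIndependent : List Bool → ∀ {n} → Subset n → Bool
pathsIndependent [] _ = true
pathsIndependent (a ∷ as) (x ∷ y ∷ S) = (not (a ∧ x) ∧ not (x ∧ y)) ∧ pathsIndependent as S
pathsIndependent (a ∷ as) _ = false

count-pathsIndependent-step : ∀ a as n j →
  count (2 + n) (pathsIndependent (a ∷ as)) (suc j) ≡
  count n (pathsIndependent as) (suc j) + weight a * count n (pathsIndependent as) j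
count-pathsIndependent-step true as n j = begin
  count (1 + n) (λ S → P (true ∷ S)) j + (c j + c (suc j))
    ≡⟨ cong (_+ (c j + c (suc j))) (count-reject (1 + n) _ j λ { (_ ∷ _) → refl }) ⟩
  c j + c (suc j)     ≡⟨ +-comm (c j) (c (suc j)) ⟩
  c (suc j) + c j     ≡⟨ cong (c (suc j) +_) (*-identityˡ (c j)) ⟨
  c (suc j) + 1 * c j ∎
  where
  open ≡-Reasoning
  P = pathsIndependent (true ∷ as)
  c = count n (pathsIndependent as)
count-pathsIndependent-step false as n j = begin
  count (1 + n) (λ S → P (true ∷ S)) j + (c j + c (suc j))
    ≡⟨ cong (_+ (c j + c (suc j))) (count-reject-true∷ n _ j (λ _ → refl)) ⟩
  c j + (c j + c (suc j)) ≡⟨ +-assoc (c j) (c j) (c (suc j)) ⟨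
  c j + c j + c (suc j)   ≡⟨ +-comm (c j + c j) (c (suc j)) ⟩
  c (suc j) + (c j + c j) ≡⟨ cong (λ x → c (suc j) + (c j + x)) (+-identityʳ (c j)) ⟨
  c (suc j) + 2 * c j     ∎
  where
  open ≡-Reasoning
  P = pathsIndependent (false ∷ as)
  c = count n (pathsIndependent as)

2+n≡2*[1+l]⇒n≡2*l : ∀ {n l} → 2 + n ≡ 2 * suc l → n ≡ 2 * l
2+n≡2*[1+l]⇒n≡2*l {l = l} eq = suc-injective (suc-injective (trans eq (*-suc 2 l)))

count-pathsIndependent : ∀ as n → n ≡ 2 * length as → ∀ j →
  count n (pathsIndependent as) j ≡ esym (map weight as) j
count-pathsIndependent [] zero _ zero = refl
count-pathsIndependent [] zero _ (suc j) = refl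
count-pathsIndependent (a ∷ as) zero ()
count-pathsIndependent (a ∷ as) (suc zero) n≡2l with suc-injective (trans n≡2l (*-suc 2 (length as)))
... | ()
count-pathsIndependent (true ∷ as) (suc (suc n)) n≡2l zero =
  count-pathsIndependent as n (2+n≡2*[1+l]⇒n≡2*l n≡2l) zero
count-pathsIndependent (false ∷ as) (suc (suc n)) n≡2l zero =
  count-pathsIndependent as n (2+n≡2*[1+l]⇒n≡2*l n≡2l) zero
count-pathsIndependent (a ∷ as) (suc (suc n)) n≡2l (suc j) = begin
  count (2 + n) (pathsIndependent (a ∷ as)) (suc j)  ≡⟨ count-pathsIndependent-step a as n j ⟩
  count n P (suc j) + weight a * count n P j         ≡⟨ cong₂ (λ x y → x + weight a * y) (ih (suc j)) (ih j) ⟩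
  esym (map weight as) (suc j) + weight a * esym (map weight as) j ∎
  where
  open ≡-Reasoning
  P = pathsIndependent as
  ih = count-pathsIndependent as n (2+n≡2*[1+l]⇒n≡2*l n≡2l)

allᵇ-cong : ∀ {A : Set} {F G : A → Bool} xs → (∀ x → F x ≡ G x) → allᵇ F xs ≡ allᵇ G xs
allᵇ-cong [] F≡G = refl
allᵇ-cong (x ∷ xs) F≡G = cong₂ _∧_ (F≡G x) (allᵇ-cong xs F≡G)

allᵇ-map : ∀ {A B : Set} (F : B → Bool) (f : A → B) xs → allᵇ F (map f xs) ≡ allᵇ (F ∘ f) xs
allᵇ-map F f [] = refl
allᵇ-map F f (x ∷ xs) = cong (F (f x) ∧_) (allᵇ-map F f xs)

allᵇ-concatMap-pair : ∀ {A B : Set} (F : B → Bool) (u v : A → B) xs →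
  allᵇ F (concatMap (λ x → u x ∷ v x ∷ []) xs) ≡ allᵇ (λ x → F (u x) ∧ F (v x)) xs
allᵇ-concatMap-pair F u v [] = refl
allᵇ-concatMap-pair F u v (x ∷ xs) =
  trans (cong (λ b → F (u x) ∧ (F (v x) ∧ b)) (allᵇ-concatMap-pair F u v xs))
        (sym (∧-assoc (F (u x)) (F (v x)) (allᵇ (λ x → F (u x) ∧ F (v x)) xs)))

applyUpTo-<ᵇ : ∀ {A : Set} (g : Bool → A) k l →
  applyUpTo (λ p → g (p <ᵇ k)) (k + l) ≡ replicate k (g true) ++ replicate l (g false)
applyUpTo-<ᵇ g zero l = applyUpTo-const l
  where
  applyUpTo-const : ∀ l → applyUpTo (λ _ → g false) l ≡ replicate l (g false)
  applyUpTo-const zero = refl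
  applyUpTo-const (suc l) = cong (g false ∷_) (applyUpTo-const l)
applyUpTo-<ᵇ g (suc k) l = cong (g true ∷_) (applyUpTo-<ᵇ g k l)

allᵇ-pendantPaths : ∀ (a : ℕ → Bool) r {n} (S : Subset n) → n ≡ 2 * r →
  allᵇ (λ p → not (a p ∧ (2 * p) ∈ˢ S) ∧ not ((2 * p) ∈ˢ S ∧ suc (2 * p) ∈ˢ S)) (upTo r) ≡
  pathsIndependent (applyUpTo a r) S
allᵇ-pendantPaths a zero S _ = refl
allᵇ-pendantPaths a (suc r) [] ()
allᵇ-pendantPaths a (suc r) (x ∷ []) n≡2r with suc-injective (trans n≡2r (*-suc 2 r))
... | ()
allᵇ-pendantPaths a (suc r) (x ∷ y ∷ S) n≡2r = cong ((not (a 0 ∧ x) ∧ not (x ∧ y)) ∧_) (begin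
  allᵇ (λ p → pathOK (a p) (2 * p)) (applyUpTo suc r)
    ≡⟨ cong (allᵇ (λ p → pathOK (a p) (2 * p))) (map-upTo suc r) ⟨
  allᵇ (λ p → pathOK (a p) (2 * p)) (map suc (upTo r))
    ≡⟨ allᵇ-map (λ p → pathOK (a p) (2 * p)) suc (upTo r) ⟩
  allᵇ (λ p → pathOK (a (suc p)) (2 * suc p)) (upTo r)
    ≡⟨ allᵇ-cong (upTo r) (λ p → cong (pathOK (a (suc p))) (*-suc 2 p)) ⟩
  allᵇ (λ p → pathOK (a (suc p)) (2 + 2 * p)) (upTo r)
    ≡⟨ allᵇ-pendantPaths (a ∘ suc) r S (2+n≡2*[1+l]⇒n≡2*l n≡2r) ⟩
  pathsIndependent (applyUpTo (a ∘ suc) r) S ∎)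
  where
  open ≡-Reasoning
  pathOK : Bool → ℕ → Bool
  pathOK b i = not (b ∧ i ∈ˢ (x ∷ y ∷ S)) ∧ not (i ∈ˢ (x ∷ y ∷ S) ∧ suc i ∈ˢ (x ∷ y ∷ S))

Σᴮ : (Bool → ℕ) → ℕ
Σᴮ f = f true + f false

Σ⁴ : (Bool → Bool → Bool → Bool → ℕ) → ℕ
Σ⁴ f = Σᴮ λ x0 → Σᴮ λ x1 → Σᴮ λ x2 → Σᴮ λ x3 → f x0 x1 x2 x3

Σᴮ-cong : ∀ {f g : Bool → ℕ} → (∀ b → f b ≡ g b) → Σᴮ f ≡ Σᴮ g
Σᴮ-cong f≡g = cong₂ _+_ (f≡g true) (f≡g false)

Σᴮ-mono : ∀ {f g : Bool → ℕ} → (∀ b → f b ≤ g b) → Σᴮ f ≤ Σᴮ g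
Σᴮ-mono f≤g = +-mono-≤ (f≤g true) (f≤g false)

Σᴮ-term : ∀ (f : Bool → ℕ) b → f b ≤ Σᴮ f
Σᴮ-term f true = m≤m+n (f true) (f false)
Σᴮ-term f false = m≤n+m (f false) (f true)

Σ⁴-cong : ∀ {f g : Bool → Bool → Bool → Bool → ℕ} →
  (∀ x0 x1 x2 x3 → f x0 x1 x2 x3 ≡ g x0 x1 x2 x3) → Σ⁴ f ≡ Σ⁴ g
Σ⁴-cong f≡g = Σᴮ-cong λ x0 → Σᴮ-cong λ x1 → Σᴮ-cong λ x2 → Σᴮ-cong λ x3 → f≡g x0 x1 x2 x3

Σ⁴-mono : ∀ {f g : Bool → Bool → Bool → Bool → ℕ} →
  (∀ x0 x1 x2 x3 → f x0 x1 x2 x3 ≤ g x0 x1 x2 x3) → Σ⁴ f ≤ Σ⁴ g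
Σ⁴-mono f≤g = Σᴮ-mono λ x0 → Σᴮ-mono λ x1 → Σᴮ-mono λ x2 → Σᴮ-mono λ x3 → f≤g x0 x1 x2 x3

Σ⁴-term : ∀ (f : Bool → Bool → Bool → Bool → ℕ) x0 x1 x2 x3 → f x0 x1 x2 x3 ≤ Σ⁴ f
Σ⁴-term f x0 x1 x2 x3 = begin
  f x0 x1 x2 x3                              ≤⟨ Σᴮ-term (f x0 x1 x2) x3 ⟩
  Σᴮ (f x0 x1 x2)                            ≤⟨ Σᴮ-term (λ y2 → Σᴮ (f x0 x1 y2)) x2 ⟩
  Σᴮ (λ y2 → Σᴮ (f x0 x1 y2))                ≤⟨ Σᴮ-term (λ y1 → Σᴮ λ y2 → Σᴮ (f x0 y1 y2)) x1 ⟩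
  Σᴮ (λ y1 → Σᴮ λ y2 → Σᴮ (f x0 y1 y2))      ≤⟨ Σᴮ-term (λ y0 → Σᴮ λ y1 → Σᴮ λ y2 → Σᴮ (f y0 y1 y2)) x0 ⟩
  Σ⁴ f                                       ∎
  where open ≤-Reasoning

count-4+ : ∀ n (P : Subset (4 + n) → Bool) j →
  count (4 + n) P (4 + j) ≡
  Σ⁴ (λ x0 x1 x2 x3 → count n (λ S → P (x0 ∷ x1 ∷ x2 ∷ x3 ∷ S)) (4 + j ∸ ∣ x0 ∷ x1 ∷ x2 ∷ x3 ∷ [] ∣))
count-4+ n P j = refl

anchorFlags : ℕ → Bool → Bool → Bool → List Bool
anchorFlags k x1 x2 x3 = replicate 3 x1 ++ replicate k x2 ++ replicate (suc k) x3

pathWeights : ℕ → Bool → Bool → Bool → List ℕ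
pathWeights k x1 x2 x3 = map weight (anchorFlags k x1 x2 x3)

hubIndependent : Bool → Bool → Bool → Bool → Bool
hubIndependent x0 x1 x2 x3 = not (x0 ∧ x1) ∧ (not (x0 ∧ x2) ∧ not (x0 ∧ x3))

isIndependent-treeG : ∀ k x0 x1 x2 x3 (S : Subset (2 * numPaths k)) →
  isIndependent (treeG k) (x0 ∷ x1 ∷ x2 ∷ x3 ∷ S) ≡
  hubIndependent x0 x1 x2 x3 ∧ pathsIndependent (anchorFlags k x1 x2 x3) S
isIndependent-treeG k x0 x1 x2 x3 S = begin
  not (x0 ∧ x1) ∧ (not (x0 ∧ x2) ∧ (not (x0 ∧ x3) ∧ allᵇ E pendantEdges))
    ≡⟨ cong (λ b → not (x0 ∧ x1) ∧ (not (x0 ∧ x2) ∧ (not (x0 ∧ x3) ∧ b))) pendantEdges-independent ⟩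
  not (x0 ∧ x1) ∧ (not (x0 ∧ x2) ∧ (not (x0 ∧ x3) ∧ R))
    ≡⟨ cong (not (x0 ∧ x1) ∧_) (∧-assoc (not (x0 ∧ x2)) (not (x0 ∧ x3)) R) ⟨
  not (x0 ∧ x1) ∧ ((not (x0 ∧ x2) ∧ not (x0 ∧ x3)) ∧ R)
    ≡⟨ ∧-assoc (not (x0 ∧ x1)) (not (x0 ∧ x2) ∧ not (x0 ∧ x3)) R ⟨
  hubIndependent x0 x1 x2 x3 ∧ R ∎
  where
  open ≡-Reasoning
  V = x0 ∷ x1 ∷ x2 ∷ x3 ∷ S
  R = pathsIndependent (anchorFlags k x1 x2 x3) S
  E : ℕ × ℕ → Bool
  E = λ { (u , v) → not ((u ∈ˢ V) ∧ (v ∈ˢ V)) }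
  pendantEdges : List (ℕ × ℕ)
  pendantEdges = concatMap (λ p → (attach k p , 4 + 2 * p) ∷ (4 + 2 * p , 5 + 2 * p) ∷ []) (upTo (numPaths k))
  -- attach k (3 + p) computes to if p <ᵇ k then 2 else 3.
  anchors : applyUpTo (λ p → attach k p ∈ˢ V) (numPaths k) ≡ anchorFlags k x1 x2 x3
  anchors = cong (λ as → x1 ∷ x1 ∷ x1 ∷ as) (begin
    applyUpTo (λ p → (if p <ᵇ k then 2 else 3) ∈ˢ V) (k + (k + 1))
      ≡⟨ applyUpTo-<ᵇ (λ b → (if b then 2 else 3) ∈ˢ V) k (k + 1) ⟩
    replicate k x2 ++ replicate (k + 1) x3
      ≡⟨ cong (λ l → replicate k x2 ++ replicate l x3) (+-comm k 1) ⟩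
    replicate k x2 ++ replicate (suc k) x3 ∎)
  pendantEdges-independent : allᵇ E pendantEdges ≡ R
  pendantEdges-independent = begin
    allᵇ E pendantEdges
      ≡⟨ allᵇ-concatMap-pair E (λ p → attach k p , 4 + 2 * p) (λ p → 4 + 2 * p , 5 + 2 * p) (upTo (numPaths k)) ⟩
    allᵇ (λ p → E (attach k p , 4 + 2 * p) ∧ E (4 + 2 * p , 5 + 2 * p)) (upTo (numPaths k))
      ≡⟨ allᵇ-pendantPaths (λ p → attach k p ∈ˢ V) (numPaths k) S refl ⟩
    pathsIndependent (applyUpTo (λ p → attach k p ∈ˢ V) (numPaths k)) S
      ≡⟨ cong (λ as → pathsIndependent as S) anchors ⟩
    R ∎

length-anchorFlags : ∀ k x1 x2 x3 → length (anchorFlags k x1 x2 x3) ≡ numPaths k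
length-anchorFlags k x1 x2 x3 = cong (3 +_) (begin
  length (replicate k x2 ++ replicate (suc k) x3)               ≡⟨ length-++ (replicate k x2) ⟩
  length (replicate k x2) + length (replicate (suc k) x3)       ≡⟨ cong₂ _+_ (length-replicate k) (length-replicate (suc k)) ⟩
  k + suc k                                                     ≡⟨ cong (k +_) (+-comm 1 k) ⟩
  k + (k + 1)                                                   ∎)
  where open ≡-Reasoning

length-pathWeights : ∀ k x1 x2 x3 → length (pathWeights k x1 x2 x3) ≡ numPaths k
length-pathWeights k x1 x2 x3 = trans (length-map weight (anchorFlags k x1 x2 x3)) (length-anchorFlags k x1 x2 x3)

count-treeG-hub : ∀ k x0 x1 x2 x3 i →
  count (2 * numPaths k) (λ S → isIndependent (treeG k) (x0 ∷ x1 ∷ x2 ∷ x3 ∷ S)) i ≡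
  (if hubIndependent x0 x1 x2 x3 then esym (pathWeights k x1 x2 x3) i else 0)
count-treeG-hub k x0 x1 x2 x3 i = begin
  count n (λ S → isIndependent (treeG k) (x0 ∷ x1 ∷ x2 ∷ x3 ∷ S)) i
    ≡⟨ count-cong n i (isIndependent-treeG k x0 x1 x2 x3) ⟩
  count n (λ S → hub ∧ paths S) i
    ≡⟨ count-∧ˡ n hub paths i ⟩
  (if hub then count n paths i else 0)
    ≡⟨ cong (if hub then_else 0) (count-pathsIndependent flags n n≡2*length i) ⟩
  (if hub then esym (pathWeights k x1 x2 x3) i else 0) ∎
  where
  open ≡-Reasoning
  n = 2 * numPaths k
  hub = hubIndependent x0 x1 x2 x3
  flags = anchorFlags k x1 x2 x3
  paths = pathsIndependent flags
  n≡2*length = cong (2 *_) (sym (length-anchorFlags k x1 x2 x3))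

hubTerm : ℕ → ℕ → Bool → Bool → Bool → Bool → ℕ
hubTerm k i x0 x1 x2 x3 =
  if hubIndependent x0 x1 x2 x3 then esym (pathWeights k x1 x2 x3) (i ∸ ∣ x0 ∷ x1 ∷ x2 ∷ x3 ∷ [] ∣) else 0

indepCount-treeG : ∀ k j → indepCount (treeG k) (4 + j) ≡ Σ⁴ (hubTerm k (4 + j))
indepCount-treeG k j = begin
  indepCount (treeG k) (4 + j)                    ≡⟨ indepCount≡count (treeG k) (4 + j) ⟩
  count (4 + n) (isIndependent (treeG k)) (4 + j) ≡⟨ count-4+ n (isIndependent (treeG k)) j ⟩
  Σ⁴ (λ x0 x1 x2 x3 → count n (λ S → isIndependent (treeG k) (x0 ∷ x1 ∷ x2 ∷ x3 ∷ S)) (i x0 x1 x2 x3))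
    ≡⟨ Σ⁴-cong (λ x0 x1 x2 x3 → count-treeG-hub k x0 x1 x2 x3 (i x0 x1 x2 x3)) ⟩
  Σ⁴ (hubTerm k (4 + j))                          ∎
  where
  open ≡-Reasoning
  n = 2 * numPaths k
  i : Bool → Bool → Bool → Bool → ℕ
  i x0 x1 x2 x3 = 4 + j ∸ ∣ x0 ∷ x1 ∷ x2 ∷ x3 ∷ [] ∣

product-replicate : ∀ r x → product (replicate r x) ≡ x ^ r
product-replicate zero x = refl
product-replicate (suc r) x = cong (x *_) (product-replicate r x)

product-map-weight-replicate : ∀ r b → product (map weight (replicate r b)) ≡ (if b then 1 else 2 ^ r)
product-map-weight-replicate r b = trans (cong product (map-replicate weight r b)) (power b)
  where
  power : ∀ b → product (replicate r (weight b)) ≡ (if b then 1 else 2 ^ r)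
  power true = trans (product-replicate r 1) (^-zeroˡ r)
  power false = product-replicate r 2

product-map-weight-++ : ∀ xs ys → product (map weight (xs ++ ys)) ≡ product (map weight xs) * product (map weight ys)
product-map-weight-++ xs ys = trans (cong product (map-++ weight xs ys)) (product-++ (map weight xs) (map weight ys))

pathsTop : ℕ → Bool → Bool → Bool → ℕ
pathsTop k x1 x2 x3 = (if x1 then 1 else 8) * ((if x2 then 1 else 2 ^ k) * (if x3 then 1 else 2 ^ suc k))

esym-pathWeights-top : ∀ k x1 x2 x3 → esym (pathWeights k x1 x2 x3) (numPaths k) ≡ pathsTop k x1 x2 x3
esym-pathWeights-top k x1 x2 x3 = begin
  esym (pathWeights k x1 x2 x3) (numPaths k)
    ≡⟨ cong (esym (pathWeights k x1 x2 x3)) (length-pathWeights k x1 x2 x3) ⟨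
  esym (pathWeights k x1 x2 x3) (length (pathWeights k x1 x2 x3))
    ≡⟨ esym-top (pathWeights k x1 x2 x3) ⟩
  product (map weight (replicate 3 x1 ++ replicate k x2 ++ replicate (suc k) x3))
    ≡⟨ product-map-weight-++ (replicate 3 x1) (replicate k x2 ++ replicate (suc k) x3) ⟩
  product (map weight (replicate 3 x1)) * product (map weight (replicate k x2 ++ replicate (suc k) x3))
    ≡⟨ cong (product (map weight (replicate 3 x1)) *_) (product-map-weight-++ (replicate k x2) (replicate (suc k) x3)) ⟩
  product (map weight (replicate 3 x1)) *
    (product (map weight (replicate k x2)) * product (map weight (replicate (suc k) x3)))
    ≡⟨ cong₂ (λ a b → a * b) (product-map-weight-replicate 3 x1)
         (cong₂ _*_ (product-map-weight-replicate k x2) (product-map-weight-replicate (suc k) x3)) ⟩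
  pathsTop k x1 x2 x3 ∎
  where open ≡-Reasoning

esym-pathWeights-above : ∀ k x1 x2 x3 {i} → numPaths k < i → esym (pathWeights k x1 x2 x3) i ≡ 0
esym-pathWeights-above k x1 x2 x3 {i} m<i =
  esym-above (pathWeights k x1 x2 x3) (subst (_< i) (sym (length-pathWeights k x1 x2 x3)) m<i)

esym-pathWeights-all-anchored : ∀ k → esym (pathWeights k true true true) (2 + (k + (k + 1))) ≡ numPaths k
esym-pathWeights-all-anchored k = begin
  esym (pathWeights k true true true) (2 + (k + (k + 1)))
    ≡⟨ esym-all-one (map⁺ all-anchored) (2 + (k + (k + 1))) ⟩
  length (pathWeights k true true true) C (2 + (k + (k + 1)))
    ≡⟨ cong (_C (2 + (k + (k + 1)))) (length-pathWeights k true true true) ⟩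
  numPaths k C (2 + (k + (k + 1)))
    ≡⟨ [1+n]C[n]≡1+n (2 + (k + (k + 1))) ⟩
  numPaths k ∎
  where
  open ≡-Reasoning
  all-anchored : All (λ b → weight b ≡ 1) (anchorFlags k true true true)
  all-anchored = ++⁺ (replicate⁺ 3 refl) (++⁺ (replicate⁺ k refl) (replicate⁺ (suc k) refl))

-- The coefficients s_{m+1}, s_{m+2}, s_{m+3}

terms[2+m] : ℕ → Bool → Bool → Bool → Bool → ℕ
terms[2+m] k false true  true  true  = numPaths k
terms[2+m] k false true  true  false = pathsTop k true true false
terms[2+m] k false true  false true  = pathsTop k true false true
terms[2+m] k false false true  true  = pathsTop k false true true
terms[2+m] k _     _     _     _     = 0

hubTerm≡terms[2+m] : ∀ k x0 x1 x2 x3 → hubTerm k (2 + numPaths k) x0 x1 x2 x3 ≡ terms[2+m] k x0 x1 x2 x3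
hubTerm≡terms[2+m] k true  true  _     _     = refl
hubTerm≡terms[2+m] k true  false true  _     = refl
hubTerm≡terms[2+m] k true  false false true  = refl
hubTerm≡terms[2+m] k true  false false false = esym-pathWeights-above k false false false (n<1+n _)
hubTerm≡terms[2+m] k false true  true  true  = esym-pathWeights-all-anchored k
hubTerm≡terms[2+m] k false true  true  false = esym-pathWeights-top k true true false
hubTerm≡terms[2+m] k false true  false true  = esym-pathWeights-top k true false true
hubTerm≡terms[2+m] k false true  false false = esym-pathWeights-above k true false false (n<1+n _)
hubTerm≡terms[2+m] k false false true  true  = esym-pathWeights-top k false true true
hubTerm≡terms[2+m] k false false true  false = esym-pathWeights-above k false true false (n<1+n _)
hubTerm≡terms[2+m] k false false false true  = esym-pathWeights-above k false false true (n<1+n _)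
hubTerm≡terms[2+m] k false false false false = esym-pathWeights-above k false false false (m<n⇒m<1+n (n<1+n _))

lowerTerms[1+m] : ℕ → Bool → Bool → Bool → Bool → ℕ
lowerTerms[1+m] k true  false false false = pathsTop k false false false
lowerTerms[1+m] k false true  false false = pathsTop k true false false
lowerTerms[1+m] k false false true  false = pathsTop k false true false
lowerTerms[1+m] k false false false true  = pathsTop k false false true
lowerTerms[1+m] k _     _     _     _     = 0

lowerTerms[1+m]≤hubTerm : ∀ k x0 x1 x2 x3 → lowerTerms[1+m] k x0 x1 x2 x3 ≤ hubTerm k (1 + numPaths k) x0 x1 x2 x3
lowerTerms[1+m]≤hubTerm k true  false false false = ≤-reflexive (sym (esym-pathWeights-top k false false false))
lowerTerms[1+m]≤hubTerm k false true  false false = ≤-reflexive (sym (esym-pathWeights-top k true false false))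
lowerTerms[1+m]≤hubTerm k false false true  false = ≤-reflexive (sym (esym-pathWeights-top k false true false))
lowerTerms[1+m]≤hubTerm k false false false true  = ≤-reflexive (sym (esym-pathWeights-top k false false true))
lowerTerms[1+m]≤hubTerm k true  true  _     _     = z≤n
lowerTerms[1+m]≤hubTerm k true  false true  _     = z≤n
lowerTerms[1+m]≤hubTerm k true  false false true  = z≤n
lowerTerms[1+m]≤hubTerm k false true  true  _     = z≤n
lowerTerms[1+m]≤hubTerm k false true  false true  = z≤n
lowerTerms[1+m]≤hubTerm k false false true  true  = z≤n
lowerTerms[1+m]≤hubTerm k false false false false = z≤n

-- In the two sums below, the second line is what Σ⁴ computes to; its zeros are left over
-- from the vanishing hub configurations.
Σ⁴-terms[2+m] : ∀ k → Σ⁴ (terms[2+m] k) ≡ numPaths k + 8 + 3 * 2 ^ k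
Σ⁴-terms[2+m] k = begin
  Σ⁴ (terms[2+m] k)
    ≡⟨⟩
  numPaths k + pathsTop k true true false + (pathsTop k true false true + 0) + (pathsTop k false true true + 0 + 0)
    ≡⟨ identity (numPaths k) (2 ^ k) ⟩
  numPaths k + 8 + 3 * 2 ^ k ∎
  where
  open ≡-Reasoning
  identity : ∀ m X → m + 1 * (1 * (2 * X)) + (1 * (X * 1) + 0) + (8 * (1 * 1) + 0 + 0) ≡ m + 8 + 3 * X
  identity = solve-∀

Σ⁴-lowerTerms[1+m] : ∀ k → Σ⁴ (lowerTerms[1+m] k) ≡ 18 * 2 ^ k * 2 ^ k + 24 * 2 ^ k
Σ⁴-lowerTerms[1+m] k = begin
  Σ⁴ (lowerTerms[1+m] k)
    ≡⟨⟩
  pathsTop k false false false + (pathsTop k true false false + (pathsTop k false true false + (pathsTop k false false true + 0)))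
    ≡⟨ identity (2 ^ k) ⟩
  18 * 2 ^ k * 2 ^ k + 24 * 2 ^ k ∎
  where
  open ≡-Reasoning
  identity : ∀ X → 8 * (X * (2 * X)) + (1 * (X * (2 * X)) + (8 * (1 * (2 * X)) + (8 * (X * 1) + 0)))
                   ≡ 18 * X * X + 24 * X
  identity = solve-∀

indepCount-treeG[1+m]≥ : ∀ k → 18 * 2 ^ k * 2 ^ k + 24 * 2 ^ k ≤ indepCount (treeG k) (1 + numPaths k)
indepCount-treeG[1+m]≥ k = begin
  18 * 2 ^ k * 2 ^ k + 24 * 2 ^ k       ≡⟨ Σ⁴-lowerTerms[1+m] k ⟨
  Σ⁴ (lowerTerms[1+m] k)                ≤⟨ Σ⁴-mono (lowerTerms[1+m]≤hubTerm k) ⟩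
  Σ⁴ (hubTerm k (1 + numPaths k))       ≡⟨ indepCount-treeG k (k + (k + 1)) ⟨
  indepCount (treeG k) (1 + numPaths k) ∎
  where open ≤-Reasoning

indepCount-treeG[2+m] : ∀ k → indepCount (treeG k) (2 + numPaths k) ≡ numPaths k + 8 + 3 * 2 ^ k
indepCount-treeG[2+m] k = begin
  indepCount (treeG k) (2 + numPaths k) ≡⟨ indepCount-treeG k (1 + (k + (k + 1))) ⟩
  Σ⁴ (hubTerm k (2 + numPaths k))       ≡⟨ Σ⁴-cong (hubTerm≡terms[2+m] k) ⟩
  Σ⁴ (terms[2+m] k)                     ≡⟨ Σ⁴-terms[2+m] k ⟩
  numPaths k + 8 + 3 * 2 ^ k            ∎
  where open ≡-Reasoning

indepCount-treeG[3+m]≥1 : ∀ k → 1 ≤ indepCount (treeG k) (3 + numPaths k)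
indepCount-treeG[3+m]≥1 k = begin
  1                                               ≡⟨ esym-pathWeights-top k true true true ⟨
  hubTerm k (3 + numPaths k) false true true true ≤⟨ Σ⁴-term (hubTerm k (3 + numPaths k)) false true true true ⟩
  Σ⁴ (hubTerm k (3 + numPaths k))                 ≡⟨ indepCount-treeG k (2 + (k + (k + 1))) ⟨
  indepCount (treeG k) (3 + numPaths k)           ∎
  where open ≤-Reasoning

n<2^n : ∀ n → n < 2 ^ n
n<2^n zero = s≤s z≤n
n<2^n (suc n) = begin-strict
  suc n         <⟨ s≤s (n<2^n n) ⟩
  1 + 2 ^ n     ≤⟨ +-monoˡ-≤ (2 ^ n) (m^n>0 2 n) ⟩
  2 ^ n + 2 ^ n ≡⟨ cong (2 ^ n +_) (+-identityʳ (2 ^ n)) ⟨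
  2 ^ suc n     ∎
  where open ≤-Reasoning

2*k+8≤2^k : ∀ {k} → 4 ≤ k → 2 * k + 8 ≤ 2 ^ k
2*k+8≤2^k (s≤s (s≤s (s≤s (s≤s (z≤n {t}))))) = begin
  2 * (4 + t) + 8 ≡⟨ linear t ⟩
  16 + 2 * t      ≤⟨ +-monoʳ-≤ 16 (*-monoˡ-≤ t {2} {16} (s≤s (s≤s z≤n))) ⟩
  16 + 16 * t     ≡⟨ *-suc 16 t ⟨
  16 * suc t      ≤⟨ *-monoʳ-≤ 16 (n<2^n t) ⟩
  16 * 2 ^ t      ≡⟨ ^-distribˡ-+-* 2 4 t ⟨
  2 ^ (4 + t)     ∎
  where
  open ≤-Reasoning
  linear : ∀ t → 2 * (4 + t) + 8 ≡ 16 + 2 * t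
  linear = solve-∀

square-gap : ∀ a X → a ≤ X + 4 → 16 ≤ X → (a + 3 * X) * (a + 3 * X) < 18 * X * X + 24 * X
square-gap a X a≤X+4 16≤X = begin-strict
  (a + 3 * X) * (a + 3 * X)         ≤⟨ *-mono-≤ a+3X≤X+4+3X a+3X≤X+4+3X ⟩
  (X + 4 + 3 * X) * (X + 4 + 3 * X) <⟨ subst (λ Y → (Y + 4 + 3 * Y) * (Y + 4 + 3 * Y) < 18 * Y * Y + 24 * Y)
                                             (m+[n∸m]≡n 16≤X) (gap (X ∸ 16)) ⟩
  18 * X * X + 24 * X               ∎
  where
  open ≤-Reasoning
  a+3X≤X+4+3X = +-monoˡ-≤ (3 * X) a≤X+4
  identity : ∀ e → suc ((16 + e + 4 + 3 * (16 + e)) * (16 + e + 4 + 3 * (16 + e))) + (367 + 56 * e + 2 * e * e)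
                   ≡ 18 * (16 + e) * (16 + e) + 24 * (16 + e)
  identity = solve-∀
  gap : ∀ e → (16 + e + 4 + 3 * (16 + e)) * (16 + e + 4 + 3 * (16 + e)) < 18 * (16 + e) * (16 + e) + 24 * (16 + e)
  gap e = subst (suc ((16 + e + 4 + 3 * (16 + e)) * (16 + e + 4 + 3 * (16 + e))) ≤_) (identity e) (m≤m+n _ _)

coefficient-gap : ∀ k → 4 ≤ k →
  (numPaths k + 8 + 3 * 2 ^ k) * (numPaths k + 8 + 3 * 2 ^ k) < 18 * 2 ^ k * 2 ^ k + 24 * 2 ^ k
coefficient-gap k 4≤k = square-gap (numPaths k + 8) (2 ^ k) m+8≤X+4 16≤X
  where
  open ≤-Reasoning
  linear : ∀ k → 3 + k + (k + 1) + 8 ≡ 2 * k + 8 + 4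
  linear = solve-∀
  m+8≤X+4 : numPaths k + 8 ≤ 2 ^ k + 4
  m+8≤X+4 = begin
    numPaths k + 8 ≡⟨ linear k ⟩
    2 * k + 8 + 4  ≤⟨ +-monoˡ-≤ 4 (2*k+8≤2^k 4≤k) ⟩
    2 ^ k + 4      ∎
  16≤X : 16 ≤ 2 ^ k
  16≤X = ≤-trans (+-monoˡ-≤ 8 (*-monoʳ-≤ 2 4≤k)) (2*k+8≤2^k 4≤k)

mainTheorem1 : (k : ℕ) → 4 ≤ k → ¬ IndepPolyLogConcave (treeG k)
mainTheorem1 k 4≤k logConcave = <⇒≱ (coefficient-gap k 4≤k) (begin
  18 * X * X + 24 * X               ≡⟨ *-identityʳ (18 * X * X + 24 * X) ⟨
  (18 * X * X + 24 * X) * 1         ≤⟨ *-mono-≤ (indepCount-treeG[1+m]≥ k) (indepCount-treeG[3+m]≥1 k) ⟩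
  s (1 + m) * s (3 + m)             ≡⟨ cong (λ i → s (1 + m) * s i) (+-comm (2 + m) 1) ⟨
  s (1 + m) * s (2 + m + 1)         ≤⟨ logConcave (2 + m) (s≤s z≤n) 3+m≤order ⟩
  s (2 + m) * s (2 + m)             ≡⟨ cong₂ _*_ (indepCount-treeG[2+m] k) (indepCount-treeG[2+m] k) ⟩
  (m + 8 + 3 * X) * (m + 8 + 3 * X) ∎)
  where
  open ≤-Reasoning
  X = 2 ^ k
  m = numPaths k
  s = indepCount (treeG k)
  3+m≤order : 3 + m ≤ order (treeG k)
  3+m≤order = +-monoʳ-≤ 3 (≤-trans (n≤1+n m) (+-monoʳ-≤ 1 (m≤m+n m (m + 0))))
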